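{- As formal power series in $q$, $$\sum_{n\geq 0}\widetilde G_n(a,b,c,d;t)q^n=\frac{t^{ -1}+(d-c)q+(b-a)q^2-\sqrt{t^{ -2}-2t^{ -1}(c+d)q+((c+d)^2-2t^{ -1}(a+b))q^2+2(a-b)(c-d)q^3+(a-b)^2q^4}}{2q},$$ where the square root is the power series in $q$ with constant term $t^{ -1}$.
   Context: A plane tree is an unlabeled rooted tree in which the children of every vertex are linearly ordered; $\mathcal P_n$ is the set of plane trees with $n$ edges. A leaf is a vertex with no children, an interior vertex one with at least one child. A leaf without siblings is a singleton leaf; a leaf with siblings is an elder leaf if it is the leftmost child of its parent, and a young leaf otherwise; an interior vertex is a young interior vertex if it is not the parent of a singleton leaf or of an elder leaf. An edge is a young edge if its lower endpoint (the child) is neither a singleton leaf nor an elder leaf. For $T\in\mathcal P_n$, $\mathrm{sleaf},\mathrm{eleaf},\mathrm{yleaf},\mathrm{yint},\mathrm{yedge}$ count singleton leaves, elder leaves, young leaves, young interior vertices and young edges. For $n\ge2$, $\widetilde G_n(a,b,c,d;t)=\sum_{T\in\mathcal P_n}a^{\mathrm{sleaf}(T)}b^{\mathrm{eleaf}(T)}c^{\mathrm{yleaf}(T)}d^{\mathrm{yint}(T)}t^{\mathrm{yedge}(T)}$, and by convention $\widetilde G_0=d$, $\widetilde G_1=b$. -}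

module Defs where

open import Data.Nat as ℕ using (ℕ; zero; suc; _∸_)
open import Data.Bool using (Bool; true; false; _∧_; not; if_then_else_)
open import Data.List using (List; []; _∷_; [_]; length; map; concatMap; upTo; foldr)
open import Data.Rational using (ℚ; 0ℚ; 1ℚ; _+_; _*_; _-_; -_; 1/_; ½; NonZero)
open import Relation.Binary.PropositionalEquality using (_≡_)
open import Data.Product using (Σ; _×_)

data Tree : Set where
  node : List Tree → Tree

Forest : Set
Forest = List Tree

isLeaf : Tree → Bool
isLeaf (node []) = true
isLeaf (node (_ ∷ _)) = false

-- Generic count over all vertices and all (parent, child) pairs.
-- vtx cs       : contribution of a vertex whose children list is cs
-- chd sibs i c : contribution of the child c at position i (0 = leftmost)
--                in the children list sibs of its parent
module Count (vtx : List Tree → ℕ) (chd : List Tree → ℕ → Tree → ℕ) where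
  mutual
    countT : Tree → ℕ
    countT (node cs) = vtx cs ℕ.+ countCs cs 0 cs

    countCs : List Tree → ℕ → List Tree → ℕ
    countCs sibs i [] = 0
    countCs sibs i (c ∷ rest) = chd sibs i c ℕ.+ countT c ℕ.+ countCs sibs (suc i) rest

b2n : Bool → ℕ
b2n true = 1
b2n false = 0

isZero : ℕ → Bool
isZero zero = true
isZero (suc _) = false

isOne : ℕ → Bool
isOne (suc zero) = true
isOne _ = false

-- number of edges = number of non-root vertices
edges : Tree → ℕ
edges = Count.countT (λ _ → 0) (λ _ _ _ → 1)

singletonLeaf : List Tree → ℕ → Tree → Bool
singletonLeaf sibs i c = isLeaf c ∧ isOne (length sibs)

elderLeaf : List Tree → ℕ → Tree → Bool
elderLeaf sibs i c = isLeaf c ∧ not (isOne (length sibs)) ∧ isZero i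

youngLeaf : List Tree → ℕ → Tree → Bool
youngLeaf sibs i c = isLeaf c ∧ not (isOne (length sibs)) ∧ not (isZero i)

anyChild : (List Tree → ℕ → Tree → Bool) → List Tree → ℕ → List Tree → Bool
anyChild p sibs i [] = false
anyChild p sibs i (c ∷ rest) = if p sibs i c then true else anyChild p sibs (suc i) rest

youngInterior : List Tree → Bool
youngInterior [] = false
youngInterior cs@(_ ∷ _) =
  not (anyChild singletonLeaf cs 0 cs) ∧ not (anyChild elderLeaf cs 0 cs)

youngEdge : List Tree → ℕ → Tree → Bool
youngEdge sibs i c = not (singletonLeaf sibs i c) ∧ not (elderLeaf sibs i c)

sleaf eleaf yleaf yint yedge : Tree → ℕ
sleaf = Count.countT (λ _ → 0) (λ s i c → b2n (singletonLeaf s i c))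
eleaf = Count.countT (λ _ → 0) (λ s i c → b2n (elderLeaf s i c))
yleaf = Count.countT (λ _ → 0) (λ s i c → b2n (youngLeaf s i c))
yint  = Count.countT (λ cs → b2n (youngInterior cs)) (λ _ _ _ → 0)
yedge = Count.countT (λ _ → 0) (λ s i c → b2n (youngEdge s i c))

-- Enumeration of plane trees with n edges.
-- forestsF fuel m : all forests (ordered lists of plane trees) with m
-- vertices in total, listed without repetition (valid when fuel > m).
-- A forest with suc m vertices is uniquely t ∷ f where t has k edges
-- (k+1 vertices, k ≤ m) and f has m ∸ k vertices.

forestsF : ℕ → ℕ → List Forest
forestsF zero _ = []
forestsF (suc f) zero = [ [] ]
forestsF (suc f) (suc m) =
  concatMap (λ k → concatMap (λ t → map (t ∷_) (forestsF f (m ∸ k)))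
                             (map node (forestsF f k)))
            (upTo (suc m))

-- 𝒫 n : the list of all plane trees with n edges (each exactly once)
𝒫 : ℕ → List Tree
𝒫 n = map node (forestsF (suc n) n)

_^_ : ℚ → ℕ → ℚ
x ^ zero = 1ℚ
x ^ suc n = x * (x ^ n)

sumℚ : List ℚ → ℚ
sumℚ = foldr _+_ 0ℚ

2ℚ : ℚ
2ℚ = 1ℚ + 1ℚ

weight : ℚ → ℚ → ℚ → ℚ → ℚ → Tree → ℚ
weight a b c d t T =
  (a ^ sleaf T) * (b ^ eleaf T) * (c ^ yleaf T) * (d ^ yint T) * (t ^ yedge T)

G̃ : ℕ → ℚ → ℚ → ℚ → ℚ → ℚ → ℚ
G̃ zero a b c d t = d
G̃ (suc zero) a b c d t = b
G̃ n@(suc (suc _)) a b c d t = sumℚ (map (weight a b c d t) (𝒫 n))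

PowerSeries : Set
PowerSeries = ℕ → ℚ

_⊛_ : PowerSeries → PowerSeries → PowerSeries
(f ⊛ g) n = sumℚ (map (λ i → f i * g (n ∸ i)) (upTo (suc n)))

-- the radicand, with u = t⁻¹:
-- u² − 2u(c+d)q + ((c+d)² − 2u(a+b))q² + 2(a−b)(c−d)q³ + (a−b)²q⁴
radicand : ℚ → ℚ → ℚ → ℚ → ℚ → PowerSeries
radicand a b c d u 0 = u * u
radicand a b c d u 1 = - (2ℚ * u * (c + d))
radicand a b c d u 2 = (c + d) * (c + d) - 2ℚ * u * (a + b)
radicand a b c d u 3 = 2ℚ * (a - b) * (c - d)
radicand a b c d u 4 = (a - b) * (a - b)
radicand a b c d u (suc (suc (suc (suc (suc _))))) = 0ℚ

IsSqrtWithConst : ℚ → PowerSeries → PowerSeries → Set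
IsSqrtWithConst u R S = (S 0 ≡ u) × (∀ n → (S ⊛ S) n ≡ R n)

numerator : ℚ → ℚ → ℚ → ℚ → ℚ → PowerSeries → PowerSeries
numerator a b c d u S 0 = u - S 0
numerator a b c d u S 1 = (d - c) - S 1
numerator a b c d u S 2 = (b - a) - S 2
numerator a b c d u S n@(suc (suc (suc _))) = - S n

module Submission where

-- The weight a^sleaf b^eleaf c^yleaf d^yint t^yedge of a plane tree is a product of local
-- factors at its vertices and edges. Let P, Q = P − 1 and Y be the weighted generating
-- functions, by number of edges, of all trees, of trees with at least one edge, and of the
-- forests hanging to the right of the leftmost child of a vertex (whose edges are all young).
-- Splitting off the leftmost subtree of the root gives
--   Y = 1 + q t (c + Q) Y,   Q = q (b Y + a − b + d t Q Y).
-- The first says Y (u − q (c + Q)) = u for u = t⁻¹, so multiplying the second by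
-- u − q (c + Q) eliminates Y:
--   (Q − q (a − b)) (u − q (c + Q)) = q (b u + d Q).
-- For F = Q + d + q (b − a) = Σ G̃ₙ qⁿ this quadratic says precisely that
-- S = u + (d − c) q + (b − a) q² − 2 q F squares to the radicand. Any other square root S′
-- with constant term u equals S, as (S + S′)(S − S′) = 0 and a power series with nonzero
-- constant term is not a zero divisor.

open import Defs
open import Data.Nat using (ℕ; suc)
open import Data.Rational using (ℚ; 0ℚ; 1/_; ½; _*_; NonZero)
open import Data.Product using (Σ; _×_)
open import Relation.Binary.PropositionalEquality using (_≡_)

open import Algebra.Bundles using (CommutativeRing; CommutativeMonoid)
import Algebra.Construct.Pointwise as Pointwise
import Algebra.Properties.CommutativeSemigroup as CommutativeSemigroupProperties
import Algebra.Solver.Ring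
open import Algebra.Solver.Ring.AlmostCommutativeRing
  using (_-Raw-AlmostCommutative⟶_) renaming (fromCommutativeRing to toAlmostCommutativeRing)
open import Data.Bool using (true; false; _∧_; not; if_then_else_)
open import Data.Bool.Properties using (∧-zeroʳ)
open import Data.List using (List; []; _∷_; [_]; _++_; map; concat; concatMap; upTo; length)
open import Data.List.Properties using (map-cong; map-cong-local; map-∘; map-++; map-upTo; map-applyUpTo; concatMap-map)
open import Data.List.Relation.Unary.All.Properties using (applyUpTo⁺₁)
open import Data.Maybe using (Maybe)
import Data.Maybe as Maybe
open import Data.Nat as ℕ using (zero; _∸_; _<_; _≤_; z≤n; s≤s)
open import Data.Nat.Properties as ℕ using (≤-refl; n<1+n; m∸n≤m; m≤n⇒m≤1+n; <-≤-trans)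
open import Data.Product using (_,_; proj₁)
open import Data.Sum using (inj₁; inj₂)
open import Data.Rational as ℚ using (1ℚ; _+_; _-_; -_)
import Data.Rational.Properties as ℚ
open import Algebra.Properties.Group ℚ.+-0-group using (x∙y⁻¹≈ε⇒x≈y)
open import Function using (_∘_)
open import Level using (0ℓ)
open import Relation.Binary.PropositionalEquality
  using (_≗_; _≢_; refl; sym; trans; cong; cong₂; module ≡-Reasoning)
open import Relation.Nullary.Decidable using (dec⇒maybe)
import Relation.Binary.Reasoning.Setoid
open import Tactic.RingSolver using (solve-∀)
open import Tactic.RingSolver.Core.AlmostCommutativeRing using (AlmostCommutativeRing; fromCommutativeRing)

open CommutativeSemigroupProperties (CommutativeMonoid.commutativeSemigroup ℚ.+-0-commutativeMonoid)
  using () renaming (x∙yz≈y∙xz to +-left-comm; interchange to +-interchange)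
open CommutativeSemigroupProperties (CommutativeMonoid.commutativeSemigroup ℚ.*-1-commutativeMonoid)
  using () renaming (interchange to *-interchange)

ℚ-ring : AlmostCommutativeRing 0ℓ 0ℓ
ℚ-ring = fromCommutativeRing ℚ.+-*-commutativeRing (λ x → dec⇒maybe (0ℚ ℚ.≟ x))

-- Finite sums

sum-++ : (xs ys : List ℚ) → sumℚ (xs ++ ys) ≡ sumℚ xs + sumℚ ys
sum-++ []       ys = sym (ℚ.+-identityˡ _)
sum-++ (x ∷ xs) ys = trans (cong (x +_) (sum-++ xs ys)) (sym (ℚ.+-assoc x _ _))

module _ {A : Set} where

  sum-map-cong : {f g : A → ℚ} → f ≗ g → (xs : List A) → sumℚ (map f xs) ≡ sumℚ (map g xs)
  sum-map-cong f≗g xs = cong sumℚ (map-cong f≗g xs)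

  sum-*ˡ : (k : ℚ) (f : A → ℚ) (xs : List A) → sumℚ (map (λ x → k * f x) xs) ≡ k * sumℚ (map f xs)
  sum-*ˡ k f []       = sym (ℚ.*-zeroʳ k)
  sum-*ˡ k f (x ∷ xs) = trans (cong (k * f x +_) (sum-*ˡ k f xs)) (sym (ℚ.*-distribˡ-+ k (f x) _))

  sum-*ʳ : (k : ℚ) (f : A → ℚ) (xs : List A) → sumℚ (map (λ x → f x * k) xs) ≡ sumℚ (map f xs) * k
  sum-*ʳ k f xs = trans (sum-map-cong (λ x → ℚ.*-comm (f x) k) xs)
                        (trans (sum-*ˡ k f xs) (ℚ.*-comm k _))

  sum-concatMap : {B : Set} (g : B → ℚ) (h : A → List B) (xs : List A) →
                  sumℚ (map g (concatMap h xs)) ≡ sumℚ (map (λ x → sumℚ (map g (h x))) xs)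
  sum-concatMap g h []       = refl
  sum-concatMap g h (x ∷ xs) = begin
      sumℚ (map g (h x ++ concatMap h xs))
    ≡⟨ cong sumℚ (map-++ g (h x) (concatMap h xs)) ⟩
      sumℚ (map g (h x) ++ map g (concatMap h xs))
    ≡⟨ sum-++ (map g (h x)) _ ⟩
      sumℚ (map g (h x)) + sumℚ (map g (concatMap h xs))
    ≡⟨ cong (sumℚ (map g (h x)) +_) (sum-concatMap g h xs) ⟩
      sumℚ (map g (h x)) + sumℚ (map (λ y → sumℚ (map g (h y))) xs) ∎
    where open ≡-Reasoning

sum-upTo-suc : (f : ℕ → ℚ) (n : ℕ) → sumℚ (map f (upTo (suc n))) ≡ f 0 + sumℚ (map (f ∘ suc) (upTo n))
sum-upTo-suc f n = cong (f 0 +_) (cong sumℚ (trans (map-applyUpTo suc f n) (sym (map-upTo (f ∘ suc) n))))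

-- Power series

infixl 6 _⊕_ _⊖_
infix  8 ⊝_
infixr 7 _·_
infixr 5 _◁_

_⊕_ : PowerSeries → PowerSeries → PowerSeries
(f ⊕ g) n = f n + g n

⊝_ : PowerSeries → PowerSeries
(⊝ f) n = - f n

_⊖_ : PowerSeries → PowerSeries → PowerSeries
f ⊖ g = f ⊕ ⊝ g

_·_ : ℚ → PowerSeries → PowerSeries
(k · f) n = k * f n

_◁_ : ℚ → PowerSeries → PowerSeries
(k ◁ f) zero    = k
(k ◁ f) (suc n) = f n

tail : PowerSeries → PowerSeries
tail f n = f (suc n)

𝟎 : PowerSeries
𝟎 _ = 0ℚ

const : ℚ → PowerSeries
const k = k ◁ 𝟎

𝟏 : PowerSeries
𝟏 = const 1ℚ

X : PowerSeries
X = 0ℚ ◁ 𝟏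

◁-cong : ∀ k {f g} → f ≗ g → k ◁ f ≗ k ◁ g
◁-cong k f≗g zero    = refl
◁-cong k f≗g (suc n) = f≗g n

◁-tail : ∀ f → f ≗ f 0 ◁ tail f
◁-tail f zero    = refl
◁-tail f (suc n) = refl

⊛-coeff₀ : ∀ f g → (f ⊛ g) 0 ≡ f 0 * g 0
⊛-coeff₀ f g = ℚ.+-identityʳ _

tail-⊛ : ∀ f g → tail (f ⊛ g) ≗ f 0 · tail g ⊕ tail f ⊛ g
tail-⊛ f g n = cong (f 0 * g (suc n) +_) (cong sumℚ
  (trans (map-applyUpTo suc (λ i → f i * g (suc n ∸ i)) (suc n))
         (sym (map-upTo (λ i → f (suc i) * g (n ∸ i)) (suc n)))))

tail-⊛ʳ : ∀ f g n → tail (f ⊛ g) n ≡ f (suc n) * g 0 + (f ⊛ tail g) n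
tail-⊛ʳ f g zero = begin
    (f ⊛ g) 1                       ≡⟨ tail-⊛ f g 0 ⟩
    f 0 * g 1 + (tail f ⊛ g) 0      ≡⟨ cong (f 0 * g 1 +_) (⊛-coeff₀ (tail f) g) ⟩
    f 0 * g 1 + f 1 * g 0           ≡⟨ ℚ.+-comm (f 0 * g 1) (f 1 * g 0) ⟩
    f 1 * g 0 + f 0 * g 1           ≡⟨ cong (f 1 * g 0 +_) (⊛-coeff₀ f (tail g)) ⟨
    f 1 * g 0 + (f ⊛ tail g) 0      ∎
  where open ≡-Reasoning
tail-⊛ʳ f g (suc n) = begin
    (f ⊛ g) (2 ℕ.+ n)
  ≡⟨ tail-⊛ f g (suc n) ⟩
    f 0 * g (2 ℕ.+ n) + (tail f ⊛ g) (suc n)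
  ≡⟨ cong (f 0 * g (2 ℕ.+ n) +_) (tail-⊛ʳ (tail f) g n) ⟩
    f 0 * g (2 ℕ.+ n) + (f (2 ℕ.+ n) * g 0 + (tail f ⊛ tail g) n)
  ≡⟨ +-left-comm (f 0 * g (2 ℕ.+ n)) (f (2 ℕ.+ n) * g 0) _ ⟩
    f (2 ℕ.+ n) * g 0 + (f 0 * g (2 ℕ.+ n) + (tail f ⊛ tail g) n)
  ≡⟨ cong (f (2 ℕ.+ n) * g 0 +_) (tail-⊛ f (tail g) n) ⟨
    f (2 ℕ.+ n) * g 0 + (f ⊛ tail g) (suc n) ∎
  where open ≡-Reasoning

⊛-cong : ∀ {f f′ g g′} → f ≗ f′ → g ≗ g′ → f ⊛ g ≗ f′ ⊛ g′
⊛-cong f≗f′ g≗g′ n = sum-map-cong (λ i → cong₂ _*_ (f≗f′ i) (g≗g′ (n ∸ i))) (upTo (suc n))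

⊛-congˡ : ∀ f {g g′} → g ≗ g′ → f ⊛ g ≗ f ⊛ g′
⊛-congˡ f = ⊛-cong {f} {f} (λ _ → refl)

⊛-congʳ : ∀ g {f f′} → f ≗ f′ → f ⊛ g ≗ f′ ⊛ g
⊛-congʳ g f≗f′ = ⊛-cong {g = g} {g} f≗f′ (λ _ → refl)

⊕-congˡ : ∀ f {g g′} → g ≗ g′ → f ⊕ g ≗ f ⊕ g′
⊕-congˡ f g≗g′ n = cong (f n +_) (g≗g′ n)

⊕-congʳ : ∀ g {f f′} → f ≗ f′ → f ⊕ g ≗ f′ ⊕ g
⊕-congʳ g f≗f′ n = cong (_+ g n) (f≗f′ n)

⊕-cong : ∀ {f f′ g g′} → f ≗ f′ → g ≗ g′ → f ⊕ g ≗ f′ ⊕ g′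
⊕-cong f≗f′ g≗g′ n = cong₂ _+_ (f≗f′ n) (g≗g′ n)

⊝-cong : ∀ {f f′} → f ≗ f′ → ⊝ f ≗ ⊝ f′
⊝-cong f≗f′ n = cong -_ (f≗f′ n)

⊛-comm : ∀ f g → f ⊛ g ≗ g ⊛ f
⊛-comm f g zero    = trans (⊛-coeff₀ f g) (trans (ℚ.*-comm (f 0) (g 0)) (sym (⊛-coeff₀ g f)))
⊛-comm f g (suc n) = begin
  (f ⊛ g) (suc n)                          ≡⟨ tail-⊛ f g n ⟩
  f 0 * g (suc n) + (tail f ⊛ g) n         ≡⟨ cong₂ _+_ (ℚ.*-comm (f 0) (g (suc n))) (⊛-comm (tail f) g n) ⟩
  g (suc n) * f 0 + (g ⊛ tail f) n         ≡⟨ tail-⊛ʳ g f n ⟨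
  (g ⊛ f) (suc n)                          ∎
  where open ≡-Reasoning

·-⊛ : ∀ k f g → (k · f) ⊛ g ≗ k · (f ⊛ g)
·-⊛ k f g n = trans (sum-map-cong (λ i → ℚ.*-assoc k (f i) _) (upTo (suc n)))
                    (sum-*ˡ k _ (upTo (suc n)))

𝟎-⊛ : ∀ g → 𝟎 ⊛ g ≗ 𝟎
𝟎-⊛ g n = trans (sum-*ˡ 0ℚ (λ i → g (n ∸ i)) (upTo (suc n)))
                (ℚ.*-zeroˡ (sumℚ (map (λ i → g (n ∸ i)) (upTo (suc n)))))

const-⊛ : ∀ k g → const k ⊛ g ≗ k · g
const-⊛ k g zero    = ⊛-coeff₀ (const k) g
const-⊛ k g (suc n) = trans (tail-⊛ (const k) g n)
                            (trans (cong (k * g (suc n) +_) (𝟎-⊛ g n)) (ℚ.+-identityʳ _))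

⊛-distribʳ : ∀ f g h → (f ⊕ g) ⊛ h ≗ f ⊛ h ⊕ g ⊛ h
⊛-distribʳ f g h n = trans (sum-map-cong (λ i → ℚ.*-distribʳ-+ (h (n ∸ i)) (f i) (g i)) (upTo (suc n)))
                           (sum-map-+ (upTo (suc n)))
  where
    sum-map-+ : ∀ is → sumℚ (map (λ i → f i * h (n ∸ i) + g i * h (n ∸ i)) is)
                     ≡ sumℚ (map (λ i → f i * h (n ∸ i)) is) + sumℚ (map (λ i → g i * h (n ∸ i)) is)
    sum-map-+ []       = sym (ℚ.+-identityʳ 0ℚ)
    sum-map-+ (i ∷ is) = trans (cong (f i * h (n ∸ i) + g i * h (n ∸ i) +_) (sum-map-+ is))
                               (+-interchange (f i * h (n ∸ i)) (g i * h (n ∸ i)) _ _)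

⊛-assoc : ∀ f g h → (f ⊛ g) ⊛ h ≗ f ⊛ (g ⊛ h)
⊛-assoc f g h zero = begin
  ((f ⊛ g) ⊛ h) 0     ≡⟨ ⊛-coeff₀ (f ⊛ g) h ⟩
  (f ⊛ g) 0 * h 0     ≡⟨ cong (_* h 0) (⊛-coeff₀ f g) ⟩
  f 0 * g 0 * h 0     ≡⟨ ℚ.*-assoc (f 0) (g 0) (h 0) ⟩
  f 0 * (g 0 * h 0)   ≡⟨ cong (f 0 *_) (⊛-coeff₀ g h) ⟨
  f 0 * (g ⊛ h) 0     ≡⟨ ⊛-coeff₀ f (g ⊛ h) ⟨
  (f ⊛ (g ⊛ h)) 0     ∎
  where open ≡-Reasoning
⊛-assoc f g h (suc n) = begin
    ((f ⊛ g) ⊛ h) (suc n)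
  ≡⟨ tail-⊛ (f ⊛ g) h n ⟩
    (f ⊛ g) 0 * h (suc n) + (tail (f ⊛ g) ⊛ h) n
  ≡⟨ cong₂ _+_ (cong (_* h (suc n)) (⊛-coeff₀ f g)) (⊛-congʳ h (tail-⊛ f g) n) ⟩
    f 0 * g 0 * h (suc n) + ((f 0 · tail g ⊕ tail f ⊛ g) ⊛ h) n
  ≡⟨ cong (f 0 * g 0 * h (suc n) +_) (⊛-distribʳ (f 0 · tail g) (tail f ⊛ g) h n) ⟩
    f 0 * g 0 * h (suc n) + (((f 0 · tail g) ⊛ h) n + ((tail f ⊛ g) ⊛ h) n)
  ≡⟨ cong (f 0 * g 0 * h (suc n) +_) (cong₂ _+_ (·-⊛ (f 0) (tail g) h n) (⊛-assoc (tail f) g h n)) ⟩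
    f 0 * g 0 * h (suc n) + (f 0 * (tail g ⊛ h) n + (tail f ⊛ (g ⊛ h)) n)
  ≡⟨ factor (f 0) (g 0) (h (suc n)) ((tail g ⊛ h) n) ((tail f ⊛ (g ⊛ h)) n) ⟩
    f 0 * (g 0 * h (suc n) + (tail g ⊛ h) n) + (tail f ⊛ (g ⊛ h)) n
  ≡⟨ cong (λ z → f 0 * z + (tail f ⊛ (g ⊛ h)) n) (tail-⊛ g h n) ⟨
    f 0 * (g ⊛ h) (suc n) + (tail f ⊛ (g ⊛ h)) n
  ≡⟨ tail-⊛ f (g ⊛ h) n ⟨
    (f ⊛ (g ⊛ h)) (suc n) ∎
  where
    open ≡-Reasoning
    factor : ∀ a b c d e → a * b * c + (a * d + e) ≡ a * (b * c + d) + e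
    factor = solve-∀ ℚ-ring

⊛-identityˡ : ∀ f → 𝟏 ⊛ f ≗ f
⊛-identityˡ f n = trans (const-⊛ 1ℚ f n) (ℚ.*-identityˡ (f n))

X-⊛ : ∀ f → X ⊛ f ≗ 0ℚ ◁ f
X-⊛ f zero    = trans (⊛-coeff₀ X f) (ℚ.*-zeroˡ (f 0))
X-⊛ f (suc n) = begin
  (X ⊛ f) (suc n)               ≡⟨ tail-⊛ X f n ⟩
  0ℚ * f (suc n) + (𝟏 ⊛ f) n    ≡⟨ cong₂ _+_ (ℚ.*-zeroˡ (f (suc n))) (⊛-identityˡ f n) ⟩
  0ℚ + f n                      ≡⟨ ℚ.+-identityˡ (f n) ⟩
  f n                           ∎
  where open ≡-Reasoning

◁-decompose : ∀ k f → k ◁ f ≗ const k ⊕ X ⊛ f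
◁-decompose k f zero    = sym (trans (cong (k +_) (X-⊛ f 0)) (ℚ.+-identityʳ k))
◁-decompose k f (suc n) = sym (trans (cong (0ℚ +_) (X-⊛ f (suc n))) (ℚ.+-identityˡ (f n)))

◁-horner : ∀ {k K f g} → const k ≗ K → f ≗ g → k ◁ f ≗ K ⊕ X ⊛ g
◁-horner {k} {K} {f} k≗K f≗g n =
  trans (◁-decompose k f n) (cong₂ _+_ (k≗K n) (⊛-congˡ X f≗g n))

const-+ : ∀ x y → const (x + y) ≗ const x ⊕ const y
const-+ x y zero    = refl
const-+ x y (suc n) = sym (ℚ.+-identityʳ 0ℚ)

const-* : ∀ x y → const (x * y) ≗ const x ⊛ const y
const-* x y zero    = sym (⊛-coeff₀ (const x) (const y))
const-* x y (suc n) = sym (trans (const-⊛ x (const y) (suc n)) (ℚ.*-zeroʳ x))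

const-neg : ∀ x → const (- x) ≗ ⊝ const x
const-neg x zero    = refl
const-neg x (suc n) = refl

const-sub : ∀ x y → const (x - y) ≗ const x ⊖ const y
const-sub x y n = trans (const-+ x (- y) n) (cong (const x n +_) (const-neg y n))

powerSeriesRing : CommutativeRing 0ℓ 0ℓ
powerSeriesRing = record
  { Carrier = PowerSeries
  ; _≈_ = _≗_
  ; _+_ = _⊕_
  ; _*_ = _⊛_
  ; -_ = ⊝_
  ; 0# = 𝟎
  ; 1# = 𝟏
  ; isCommutativeRing = record
    { isRing = record
      { +-isAbelianGroup = Pointwise.isAbelianGroup ℕ ℚ.+-0-isAbelianGroup
      ; *-cong = ⊛-cong
      ; *-assoc = ⊛-assoc
      ; *-identity = ⊛-identityˡ , λ f n → trans (⊛-comm f 𝟏 n) (⊛-identityˡ f n)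
      ; distrib = (λ f g h n → trans (⊛-comm f (g ⊕ h) n) (trans (⊛-distribʳ g h f n)
                                 (cong₂ _+_ (⊛-comm g f n) (⊛-comm h f n))))
                , (λ h f g → ⊛-distribʳ f g h)
      }
    ; *-comm = ⊛-comm
    }
  }

open CommutativeRing powerSeriesRing using (setoid)
  renaming (refl to ≗-refl; sym to ≗-sym; trans to ≗-trans)
module ≗-Reasoning = Relation.Binary.Reasoning.Setoid setoid

const-0 : const 0ℚ ≗ 𝟎
const-0 zero    = refl
const-0 (suc n) = refl

constMorphism : ℚ.+-*-rawRing -Raw-AlmostCommutative⟶ toAlmostCommutativeRing powerSeriesRing
constMorphism = record
  { ⟦_⟧ = const
  ; +-homo = const-+
  ; *-homo = const-*
  ; -‿homo = const-neg
  ; 0-homo = const-0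
  ; 1-homo = λ _ → refl
  }

const≟ : ∀ x y → Maybe (const x ≗ const y)
const≟ x y = Maybe.map (λ x≡y n → cong (λ k → const k n) x≡y) (dec⇒maybe (x ℚ.≟ y))

-- Constants are compared with ℚ's _≟_, so only closed rationals can be solver constants;
-- series such as const a must be passed to the solver as variables.
open Algebra.Solver.Ring ℚ.+-*-rawRing (toAlmostCommutativeRing powerSeriesRing) constMorphism const≟
  using (_:+_; _:*_; _:-_; :-_; con; _:=_) renaming (solve to solveₚ)

-- Uniqueness of square roots

⊛-vanishing : ∀ f g m → (∀ {i} → i ≤ m → g i ≡ 0ℚ) → (f ⊛ g) m ≡ 0ℚ
⊛-vanishing f g zero g≡0 = trans (⊛-coeff₀ f g) (trans (cong (f 0 *_) (g≡0 z≤n)) (ℚ.*-zeroʳ (f 0)))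
⊛-vanishing f g (suc m) g≡0 = begin
  (f ⊛ g) (suc m)                      ≡⟨ tail-⊛ f g m ⟩
  f 0 * g (suc m) + (tail f ⊛ g) m     ≡⟨ cong₂ _+_ (cong (f 0 *_) (g≡0 ≤-refl))
                                                   (⊛-vanishing (tail f) g m (g≡0 ∘ m≤n⇒m≤1+n)) ⟩
  f 0 * 0ℚ + 0ℚ                        ≡⟨ cong (_+ 0ℚ) (ℚ.*-zeroʳ (f 0)) ⟩
  0ℚ                                   ∎
  where open ≡-Reasoning

⊛-leading : ∀ f g n → (∀ {i} → i < n → g i ≡ 0ℚ) → (f ⊛ g) n ≡ f 0 * g n
⊛-leading f g zero    _    = ⊛-coeff₀ f g
⊛-leading f g (suc n) g≡0 = trans (tail-⊛ f g n)
  (trans (cong (f 0 * g (suc n) +_) (⊛-vanishing (tail f) g n (g≡0 ∘ s≤s))) (ℚ.+-identityʳ _))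

x*y≡0⇒y≡0 : ∀ x y → x ≢ 0ℚ → x * y ≡ 0ℚ → y ≡ 0ℚ
x*y≡0⇒y≡0 x y x≢0 xy≡0 = begin
  y                ≡⟨ ℚ.*-identityˡ y ⟨
  1ℚ * y           ≡⟨ cong (_* y) (ℚ.*-inverseˡ x) ⟨
  1/ x * x * y     ≡⟨ ℚ.*-assoc (1/ x) x y ⟩
  1/ x * (x * y)   ≡⟨ cong (1/ x *_) xy≡0 ⟩
  1/ x * 0ℚ        ≡⟨ ℚ.*-zeroʳ (1/ x) ⟩
  0ℚ               ∎
  where
    open ≡-Reasoning
    instance _ = ℚ.≢-nonZero x≢0

f⊛g≗𝟎⇒g≗𝟎 : ∀ f g → f 0 ≢ 0ℚ → f ⊛ g ≗ 𝟎 → g ≗ 𝟎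
f⊛g≗𝟎⇒g≗𝟎 f g f₀≢0 fg≗0 n = vanishes-below (suc n) ≤-refl
  where
    vanishes-below : ∀ n {i} → i < n → g i ≡ 0ℚ
    vanishes-below (suc n) i<1+n with ℕ.m<1+n⇒m<n∨m≡n i<1+n
    ... | inj₁ i<n  = vanishes-below n i<n
    ... | inj₂ refl = x*y≡0⇒y≡0 (f 0) (g n) f₀≢0
                        (trans (sym (⊛-leading f g n (vanishes-below n))) (fg≗0 n))

sqrt-unique : ∀ S T → S 0 + T 0 ≢ 0ℚ → S ⊛ S ≗ T ⊛ T → S ≗ T
sqrt-unique S T S₀+T₀≢0 S²≗T² n =
  x∙y⁻¹≈ε⇒x≈y (S n) (T n) (f⊛g≗𝟎⇒g≗𝟎 (S ⊕ T) (S ⊖ T) S₀+T₀≢0 difference-of-squares n)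
  where
    difference-of-squares : (S ⊕ T) ⊛ (S ⊖ T) ≗ 𝟎
    difference-of-squares m = trans
      (solveₚ 2 (λ S T → (S :+ T) :* (S :- T) := S :* S :- T :* T) ≗-refl S T m)
      (trans (cong (λ z → (S ⊛ S) m + - z) (sym (S²≗T² m))) (ℚ.+-inverseʳ ((S ⊛ S) m)))

-- Completing the square

two : PowerSeries
two = const 2ℚ

numeratorSeries : (x a b c d u : PowerSeries) → PowerSeries
numeratorSeries x a b c d u = u ⊕ x ⊛ ((d ⊖ c) ⊕ x ⊛ (b ⊖ a))

radicandSeries : (x a b c d u : PowerSeries) → PowerSeries
radicandSeries x a b c d u =
  u ⊛ u ⊕ x ⊛ (⊝ ((two ⊛ u) ⊛ (c ⊕ d))
          ⊕ x ⊛ ((c ⊕ d) ⊛ (c ⊕ d) ⊖ (two ⊛ u) ⊛ (a ⊕ b)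
          ⊕ x ⊛ ((two ⊛ (a ⊖ b)) ⊛ (c ⊖ d)
          ⊕ x ⊛ ((a ⊖ b) ⊛ (a ⊖ b)))))

tree-system-quadratic : ∀ x y q a b c d t u → t ⊛ u ≗ 𝟏 →
  y ≗ 𝟏 ⊕ x ⊛ (t ⊛ ((c ⊕ q) ⊛ y)) →
  q ≗ x ⊛ ((b ⊛ y ⊕ (a ⊖ b)) ⊕ (d ⊛ t) ⊛ (q ⊛ y)) →
  (q ⊖ x ⊛ (a ⊖ b)) ⊛ (u ⊖ x ⊛ (c ⊕ q)) ≗ x ⊛ (b ⊛ u ⊕ d ⊛ q)
tree-system-quadratic x y q a b c d t u tu≗1 y-eq q-eq = begin
    (q ⊖ x ⊛ (a ⊖ b)) ⊛ e
  ≈⟨ ⊛-congʳ e (⊕-congʳ (⊝ (x ⊛ (a ⊖ b))) q-eq) ⟩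
    (x ⊛ ((b ⊛ y ⊕ (a ⊖ b)) ⊕ (d ⊛ t) ⊛ (q ⊛ y)) ⊖ x ⊛ (a ⊖ b)) ⊛ e
  ≈⟨ solveₚ 9 (λ x y q a b c d t u →
       (x :* ((b :* y :+ (a :- b)) :+ (d :* t) :* (q :* y)) :- x :* (a :- b)) :* (u :- x :* (c :+ q))
       := (x :* (b :+ d :* (t :* q))) :* (y :* (u :- x :* (c :+ q)))) ≗-refl x y q a b c d t u ⟩
    (x ⊛ (b ⊕ d ⊛ (t ⊛ q))) ⊛ (y ⊛ e)
  ≈⟨ ⊛-congˡ (x ⊛ (b ⊕ d ⊛ (t ⊛ q))) y⊛e≗u ⟩
    (x ⊛ (b ⊕ d ⊛ (t ⊛ q))) ⊛ u
  ≈⟨ solveₚ 6 (λ x q b d t u → (x :* (b :+ d :* (t :* q))) :* u := x :* (b :* u :+ d :* ((t :* u) :* q)))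
       ≗-refl x q b d t u ⟩
    x ⊛ (b ⊛ u ⊕ d ⊛ ((t ⊛ u) ⊛ q))
  ≈⟨ ⊛-congˡ x (⊕-congˡ (b ⊛ u) (⊛-congˡ d (⊛-congʳ q tu≗1))) ⟩
    x ⊛ (b ⊛ u ⊕ d ⊛ (𝟏 ⊛ q))
  ≈⟨ solveₚ 5 (λ x q b d u → x :* (b :* u :+ d :* (con 1ℚ :* q)) := x :* (b :* u :+ d :* q)) ≗-refl x q b d u ⟩
    x ⊛ (b ⊛ u ⊕ d ⊛ q) ∎
  where
    open ≗-Reasoning
    e = u ⊖ x ⊛ (c ⊕ q)
    y⊛e≗u : y ⊛ e ≗ u
    y⊛e≗u = begin
        y ⊛ e
      ≈⟨ solveₚ 5 (λ x y q c u → y :* (u :- x :* (c :+ q)) := y :* u :- x :* ((c :+ q) :* y)) ≗-refl x y q c u ⟩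
        y ⊛ u ⊖ x ⊛ ((c ⊕ q) ⊛ y)
      ≈⟨ ⊕-congʳ (⊝ (x ⊛ ((c ⊕ q) ⊛ y))) (⊛-congʳ u y-eq) ⟩
        (𝟏 ⊕ x ⊛ (t ⊛ ((c ⊕ q) ⊛ y))) ⊛ u ⊖ x ⊛ ((c ⊕ q) ⊛ y)
      ≈⟨ solveₚ 6 (λ x y q c t u →
           (con 1ℚ :+ x :* (t :* ((c :+ q) :* y))) :* u :- x :* ((c :+ q) :* y)
           := u :+ (x :* ((c :+ q) :* y)) :* (t :* u :- con 1ℚ)) ≗-refl x y q c t u ⟩
        u ⊕ (x ⊛ ((c ⊕ q) ⊛ y)) ⊛ (t ⊛ u ⊖ 𝟏)
      ≈⟨ ⊕-congˡ u (⊛-congˡ (x ⊛ ((c ⊕ q) ⊛ y)) (⊕-congʳ (⊝ 𝟏) tu≗1)) ⟩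
        u ⊕ (x ⊛ ((c ⊕ q) ⊛ y)) ⊛ (𝟏 ⊖ 𝟏)
      ≈⟨ solveₚ 2 (λ z u → u :+ z :* (con 1ℚ :- con 1ℚ) := u) ≗-refl (x ⊛ ((c ⊕ q) ⊛ y)) u ⟩
        u ∎

completing-square : ∀ x q a b c d u →
  (q ⊖ x ⊛ (a ⊖ b)) ⊛ (u ⊖ x ⊛ (c ⊕ q)) ≗ x ⊛ (b ⊛ u ⊕ d ⊛ q) →
  let s = numeratorSeries x a b c d u ⊖ (two ⊛ x) ⊛ (q ⊕ (d ⊕ x ⊛ (b ⊖ a)))
  in s ⊛ s ≗ radicandSeries x a b c d u
completing-square x q a b c d u quadratic = begin
    s ⊛ s
  ≈⟨ solveₚ 7 (λ x q a b c d u →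
       let s = (u :+ x :* ((d :- c) :+ x :* (b :- a))) :- (con 2ℚ :* x) :* (q :+ (d :+ x :* (b :- a)))
       in s :* s
       := rad x a b c d u :+ ((con 2ℚ :* con 2ℚ) :* x) :* (x :* (b :* u :+ d :* q)
                                 :- (q :- x :* (a :- b)) :* (u :- x :* (c :+ q))))
       ≗-refl x q a b c d u ⟩
    radicandSeries x a b c d u ⊕ ((two ⊛ two) ⊛ x) ⊛ (r ⊖ (q ⊖ x ⊛ (a ⊖ b)) ⊛ (u ⊖ x ⊛ (c ⊕ q)))
  ≈⟨ ⊕-congˡ (radicandSeries x a b c d u) (⊛-congˡ ((two ⊛ two) ⊛ x) (⊕-congˡ r (λ n → cong -_ (quadratic n)))) ⟩
    radicandSeries x a b c d u ⊕ ((two ⊛ two) ⊛ x) ⊛ (r ⊖ r)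
  ≈⟨ solveₚ 3 (λ ρ y r → ρ :+ y :* (r :- r) := ρ) ≗-refl (radicandSeries x a b c d u) ((two ⊛ two) ⊛ x) r ⟩
    radicandSeries x a b c d u ∎
  where
    open ≗-Reasoning
    s = numeratorSeries x a b c d u ⊖ (two ⊛ x) ⊛ (q ⊕ (d ⊕ x ⊛ (b ⊖ a)))
    r = x ⊛ (b ⊛ u ⊕ d ⊛ q)
    rad = λ x a b c d u →
      u :* u :+ x :* (:- ((con 2ℚ :* u) :* (c :+ d))
             :+ x :* ((c :+ d) :* (c :+ d) :- (con 2ℚ :* u) :* (a :+ b)
             :+ x :* ((con 2ℚ :* (a :- b)) :* (c :- d)
             :+ x :* ((a :- b) :* (a :- b)))))

radicand-polynomial : ∀ a b c d u →
  radicand a b c d u ≗ radicandSeries X (const a) (const b) (const c) (const d) (const u)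
radicand-polynomial a b c d u =
  ≗-trans coefficients (◁-horner (const-* u u) (◁-horner r₁ (◁-horner r₂ (◁-horner r₃ r₄))))
  where
    A = const a; B = const b; C = const c; D = const d; U = const u
    coefficients : radicand a b c d u ≗ radicand a b c d u 0 ◁ radicand a b c d u 1 ◁ radicand a b c d u 2
                                        ◁ radicand a b c d u 3 ◁ const (radicand a b c d u 4)
    coefficients 0 = refl
    coefficients 1 = refl
    coefficients 2 = refl
    coefficients 3 = refl
    coefficients 4 = refl
    coefficients (suc (suc (suc (suc (suc _))))) = refl
    2u : const (2ℚ * u) ≗ two ⊛ U
    2u = const-* 2ℚ u
    r₁ : const (- (2ℚ * u * (c + d))) ≗ ⊝ ((two ⊛ U) ⊛ (C ⊕ D))
    r₁ = ≗-trans (const-neg (2ℚ * u * (c + d)))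
                 (⊝-cong (≗-trans (const-* (2ℚ * u) (c + d)) (⊛-cong 2u (const-+ c d))))
    r₂ : const ((c + d) * (c + d) - 2ℚ * u * (a + b)) ≗ (C ⊕ D) ⊛ (C ⊕ D) ⊖ (two ⊛ U) ⊛ (A ⊕ B)
    r₂ = ≗-trans (const-sub ((c + d) * (c + d)) (2ℚ * u * (a + b)))
           (⊕-cong (≗-trans (const-* (c + d) (c + d)) (⊛-cong (const-+ c d) (const-+ c d)))
                   (⊝-cong (≗-trans (const-* (2ℚ * u) (a + b)) (⊛-cong 2u (const-+ a b)))))
    r₃ : const (2ℚ * (a - b) * (c - d)) ≗ (two ⊛ (A ⊖ B)) ⊛ (C ⊖ D)
    r₃ = ≗-trans (const-* (2ℚ * (a - b)) (c - d))
                 (⊛-cong (≗-trans (const-* 2ℚ (a - b)) (⊛-congˡ two (const-sub a b))) (const-sub c d))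
    r₄ : const ((a - b) * (a - b)) ≗ (A ⊖ B) ⊛ (A ⊖ B)
    r₄ = ≗-trans (const-* (a - b) (a - b)) (⊛-cong (const-sub a b) (const-sub a b))

-- Plane trees

module TreeProduct (vtx : List Tree → ℚ) (chd : List Tree → ℕ → Tree → ℚ) where
  mutual
    productT : Tree → ℚ
    productT (node cs) = vtx cs * productCs cs 0 cs

    productCs : List Tree → ℕ → List Tree → ℚ
    productCs sibs i []         = 1ℚ
    productCs sibs i (c ∷ rest) = chd sibs i c * productT c * productCs sibs (suc i) rest

^-+ : ∀ x m n → x ^ (m ℕ.+ n) ≡ x ^ m * x ^ n
^-+ x zero    n = sym (ℚ.*-identityˡ _)
^-+ x (suc m) n = trans (cong (x *_) (^-+ x m n)) (sym (ℚ.*-assoc x _ _))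

module _ (x : ℚ) (vtx : List Tree → ℕ) (chd : List Tree → ℕ → Tree → ℕ) where
  open Count vtx chd
  open TreeProduct (λ cs → x ^ vtx cs) (λ s i c → x ^ chd s i c)

  mutual
    ^-countT : ∀ T → x ^ countT T ≡ productT T
    ^-countT (node cs) = trans (^-+ x (vtx cs) _) (cong (x ^ vtx cs *_) (^-countCs cs 0 cs))

    ^-countCs : ∀ sibs i cs → x ^ countCs sibs i cs ≡ productCs sibs i cs
    ^-countCs sibs i []         = refl
    ^-countCs sibs i (c ∷ rest) = begin
        x ^ (chd sibs i c ℕ.+ countT c ℕ.+ countCs sibs (suc i) rest)
      ≡⟨ ^-+ x (chd sibs i c ℕ.+ countT c) _ ⟩
        x ^ (chd sibs i c ℕ.+ countT c) * x ^ countCs sibs (suc i) rest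
      ≡⟨ cong₂ _*_ (^-+ x (chd sibs i c) (countT c)) (^-countCs sibs (suc i) rest) ⟩
        x ^ chd sibs i c * x ^ countT c * productCs sibs (suc i) rest
      ≡⟨ cong (λ z → x ^ chd sibs i c * z * productCs sibs (suc i) rest) (^-countT c) ⟩
        x ^ chd sibs i c * productT c * productCs sibs (suc i) rest ∎
      where open ≡-Reasoning

module _ (v v′ : List Tree → ℚ) (e e′ : List Tree → ℕ → Tree → ℚ) where
  private
    module P  = TreeProduct v e
    module P′ = TreeProduct v′ e′
    module PP = TreeProduct (λ cs → v cs * v′ cs) (λ s i c → e s i c * e′ s i c)

  mutual
    productT-* : ∀ T → P.productT T * P′.productT T ≡ PP.productT T
    productT-* (node cs) = trans (*-interchange (v cs) _ (v′ cs) _)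
                                 (cong (v cs * v′ cs *_) (productCs-* cs 0 cs))

    productCs-* : ∀ sibs i cs → P.productCs sibs i cs * P′.productCs sibs i cs ≡ PP.productCs sibs i cs
    productCs-* sibs i []         = refl
    productCs-* sibs i (c ∷ rest) = begin
        e sibs i c * P.productT c * P.productCs sibs (suc i) rest
          * (e′ sibs i c * P′.productT c * P′.productCs sibs (suc i) rest)
      ≡⟨ *-interchange (e sibs i c * P.productT c) _ (e′ sibs i c * P′.productT c) _ ⟩
        e sibs i c * P.productT c * (e′ sibs i c * P′.productT c)
          * (P.productCs sibs (suc i) rest * P′.productCs sibs (suc i) rest)
      ≡⟨ cong₂ _*_ (*-interchange (e sibs i c) (P.productT c) (e′ sibs i c) (P′.productT c))
                   (productCs-* sibs (suc i) rest) ⟩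
        e sibs i c * e′ sibs i c * (P.productT c * P′.productT c) * PP.productCs sibs (suc i) rest
      ≡⟨ cong (λ z → e sibs i c * e′ sibs i c * z * PP.productCs sibs (suc i) rest) (productT-* c) ⟩
        e sibs i c * e′ sibs i c * PP.productT c * PP.productCs sibs (suc i) rest ∎
      where open ≡-Reasoning

module _ {v v′ : List Tree → ℚ} {e e′ : List Tree → ℕ → Tree → ℚ}
         (v≗v′ : ∀ cs → v cs ≡ v′ cs) (e≗e′ : ∀ s i c → e s i c ≡ e′ s i c) where
  private
    module P  = TreeProduct v e
    module P′ = TreeProduct v′ e′

  mutual
    productT-cong : ∀ T → P.productT T ≡ P′.productT T
    productT-cong (node cs) = cong₂ _*_ (v≗v′ cs) (productCs-cong cs 0 cs)

    productCs-cong : ∀ sibs i cs → P.productCs sibs i cs ≡ P′.productCs sibs i cs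
    productCs-cong sibs i []         = refl
    productCs-cong sibs i (c ∷ rest) =
      cong₂ _*_ (cong₂ _*_ (e≗e′ sibs i c) (productT-cong c)) (productCs-cong sibs (suc i) rest)

anyChild-none : ∀ p sibs i cs → (∀ {j} c → i ≤ j → p sibs j c ≡ false) → anyChild p sibs i cs ≡ false
anyChild-none p sibs i []       _      = refl
anyChild-none p sibs i (c ∷ cs) p≡false rewrite p≡false c ≤-refl =
  anyChild-none p sibs (suc i) cs (λ c′ i<j → p≡false c′ (ℕ.<⇒≤ i<j))

youngInterior-elderLeaf : ∀ T r → youngInterior (node [] ∷ T ∷ r) ≡ false
youngInterior-elderLeaf T r = ∧-zeroʳ (not (anyChild singletonLeaf (node [] ∷ T ∷ r) 1 (T ∷ r)))

youngInterior-interiorFirst : ∀ T r′ r → youngInterior (node (T ∷ r′) ∷ r) ≡ true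
youngInterior-interiorFirst T r′ []      = refl
youngInterior-interiorFirst T r′ (S ∷ r) = cong₂ (λ p q → not p ∧ not q)
  (anyChild-none singletonLeaf cs 1 (S ∷ r) (λ c _ → ∧-zeroʳ (isLeaf c)))
  (anyChild-none elderLeaf cs 1 (S ∷ r) λ { c (s≤s _) → ∧-zeroʳ (isLeaf c) })
  where cs = node (T ∷ r′) ∷ S ∷ r

-- Forests

forests : ℕ → List Forest
forests m = forestsF (suc m) m

forestsF-fuel : ∀ {f g} m → m < f → m < g → forestsF f m ≡ forestsF g m
forestsF-fuel {suc f} {suc g} zero    _         _         = refl
forestsF-fuel {suc f} {suc g} (suc m) (s≤s m<f) (s≤s m<g) =
  cong concat (map-cong-local (applyUpTo⁺₁ (λ k → k) (suc m) λ {k} k<1+m →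
    cong₂ (λ A B → concatMap (λ T → map (T ∷_) B) (map node A))
          (forestsF-fuel k (<-≤-trans k<1+m m<f) (<-≤-trans k<1+m m<g))
          (forestsF-fuel (m ∸ k) (<-≤-trans (s≤s (m∸n≤m m k)) m<f) (<-≤-trans (s≤s (m∸n≤m m k)) m<g))))

forests-suc : ∀ m → forests (suc m) ≡
  concatMap (λ k → concatMap (λ cs → map (node cs ∷_) (forests (m ∸ k))) (forests k)) (upTo (suc m))
forests-suc m = cong concat (map-cong-local (applyUpTo⁺₁ (λ k → k) (suc m) λ {k} k<1+m →
  trans (cong₂ (λ A B → concatMap (λ T → map (T ∷_) B) (map node A))
               (forestsF-fuel k k<1+m (n<1+n k))
               (forestsF-fuel (m ∸ k) (s≤s (m∸n≤m m k)) (n<1+n (m ∸ k))))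
        (concatMap-map _ node (forests k))))

forestSum : (Forest → ℚ) → PowerSeries
forestSum g m = sumℚ (map g (forests m))

forestSum-suc : ∀ g m → forestSum g (suc m) ≡
  sumℚ (map (λ k → forestSum (λ cs → forestSum (λ r → g (node cs ∷ r)) (m ∸ k)) k) (upTo (suc m)))
forestSum-suc g m = begin
    sumℚ (map g (forests (suc m)))
  ≡⟨ cong (sumℚ ∘ map g) (forests-suc m) ⟩
    sumℚ (map g (concatMap byFirstTree (upTo (suc m))))
  ≡⟨ sum-concatMap g byFirstTree (upTo (suc m)) ⟩
    sumℚ (map (λ k → sumℚ (map g (byFirstTree k))) (upTo (suc m)))
  ≡⟨ sum-map-cong (λ k → trans (sum-concatMap g (withFirstTree k) (forests k))
                               (sum-map-cong (λ cs → cong sumℚ (sym (map-∘ {g = g} (forests (m ∸ k)))))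
                                             (forests k)))
                  (upTo (suc m)) ⟩
    sumℚ (map (λ k → forestSum (λ cs → forestSum (λ r → g (node cs ∷ r)) (m ∸ k)) k) (upTo (suc m))) ∎
  where
    open ≡-Reasoning
    withFirstTree : ℕ → Forest → List Forest
    withFirstTree k cs = map (node cs ∷_) (forests (m ∸ k))
    byFirstTree : ℕ → List Forest
    byFirstTree k = concatMap (withFirstTree k) (forests k)

forestSum-*ˡ : ∀ k g m → forestSum (λ f → k * g f) m ≡ k * forestSum g m
forestSum-*ˡ k g m = sum-*ˡ k g (forests m)

forestSum-*ʳ : ∀ k g m → forestSum (λ f → g f * k) m ≡ forestSum g m * k
forestSum-*ʳ k g m = sum-*ʳ k g (forests m)

forestSum-suc-cong : ∀ {g g′} → (∀ cs r → g (node cs ∷ r) ≡ g′ (node cs ∷ r)) →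
                     ∀ m → forestSum g (suc m) ≡ forestSum g′ (suc m)
forestSum-suc-cong {g} {g′} g≡g′ m = begin
  forestSum g (suc m)    ≡⟨ forestSum-suc g m ⟩
  _                      ≡⟨ sum-map-cong (λ k → sum-map-cong (λ cs → sum-map-cong (g≡g′ cs) (forests (m ∸ k)))
                                                             (forests k)) (upTo (suc m)) ⟩
  _                      ≡⟨ forestSum-suc g′ m ⟨
  forestSum g′ (suc m)   ∎
  where open ≡-Reasoning

forestSum-cons : ∀ {g} h g′ → (∀ cs r → g (node cs ∷ r) ≡ h cs * g′ r) →
                 ∀ m → forestSum g (suc m) ≡ (forestSum h ⊛ forestSum g′) m
forestSum-cons {g} h g′ g≡hg′ m = trans (forestSum-suc g m)
  (sum-map-cong (λ k → trans (sum-map-cong (λ cs → trans (sum-map-cong (g≡hg′ cs) (forests (m ∸ k)))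
                                                         (forestSum-*ˡ (h cs) g′ (m ∸ k))) (forests k))
                             (forestSum-*ʳ (forestSum g′ (m ∸ k)) h k))
                (upTo (suc m)))

module Weights (a b c d t : ℚ) where

  vertexWeight : List Tree → ℚ
  vertexWeight cs = d ^ b2n (youngInterior cs)

  edgeWeight : List Tree → ℕ → Tree → ℚ
  edgeWeight sibs i (node (_ ∷ _)) = t
  edgeWeight sibs i (node [])      = if isOne (length sibs) then a else if isZero i then b else c * t

  open TreeProduct vertexWeight edgeWeight public
    renaming (productT to treeWeight; productCs to childrenWeight)

  weight≡treeWeight : ∀ T → weight a b c d t T ≡ treeWeight T
  weight≡treeWeight T = begin
      weight a b c d t T
    ≡⟨ cong₂ _*_ (cong₂ _*_ (cong₂ _*_ (cong₂ _*_ (^-countT a _ _ T) (^-countT b _ _ T))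
                                      (^-countT c _ _ T)) (^-countT d _ _ T)) (^-countT t _ _ T) ⟩
      _
    ≡⟨ trans (cong (λ z → z * _ * _ * _) (productT-* _ _ _ _ T))
        (trans (cong (λ z → z * _ * _) (productT-* _ _ _ _ T))
          (trans (cong (_* _) (productT-* _ _ _ _ T)) (productT-* _ _ _ _ T))) ⟩
      TreeProduct.productT vertexFactors edgeFactors T
    ≡⟨ productT-cong (λ cs → unitFactors (vertexWeight cs)) edgeFactors≡edgeWeight T ⟩
      treeWeight T ∎
    where
      open ≡-Reasoning
      vertexFactors : List Tree → ℚ
      vertexFactors cs = 1ℚ * 1ℚ * 1ℚ * vertexWeight cs * 1ℚ
      edgeFactors : List Tree → ℕ → Tree → ℚ
      edgeFactors s i x = a ^ b2n (singletonLeaf s i x) * b ^ b2n (elderLeaf s i x)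
                          * c ^ b2n (youngLeaf s i x) * 1ℚ * t ^ b2n (youngEdge s i x)
      unitFactors : ∀ w → 1ℚ * 1ℚ * 1ℚ * w * 1ℚ ≡ w
      unitFactors = solve-∀ ℚ-ring
      edgeFactors≡edgeWeight : ∀ s i x → edgeFactors s i x ≡ edgeWeight s i x
      edgeFactors≡edgeWeight s i (node (_ ∷ _)) = interiorFactors t
        where
          interiorFactors : ∀ x → 1ℚ * 1ℚ * 1ℚ * 1ℚ * (x * 1ℚ) ≡ x
          interiorFactors = solve-∀ ℚ-ring
      edgeFactors≡edgeWeight s i (node [])      = leafFactors (isOne (length s)) (isZero i)
        where
          leafFactors : ∀ o z → a ^ b2n o * b ^ b2n (not o ∧ z) * c ^ b2n (not o ∧ not z) * 1ℚ
                                  * t ^ b2n (not o ∧ not (not o ∧ z))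
                                ≡ (if o then a else if z then b else c * t)
          leafFactors true  _     = singletonFactors a
            where singletonFactors : ∀ x → x * 1ℚ * 1ℚ * 1ℚ * 1ℚ * 1ℚ ≡ x
                  singletonFactors = solve-∀ ℚ-ring
          leafFactors false true  = elderFactors b
            where elderFactors : ∀ x → 1ℚ * (x * 1ℚ) * 1ℚ * 1ℚ * 1ℚ ≡ x
                  elderFactors = solve-∀ ℚ-ring
          leafFactors false false = youngFactors c t
            where youngFactors : ∀ x y → 1ℚ * 1ℚ * (x * 1ℚ) * 1ℚ * (y * 1ℚ) ≡ x * y
                  youngFactors = solve-∀ ℚ-ring

  youngEdgeWeight : Tree → ℚ
  youngEdgeWeight (node [])      = c * t
  youngEdgeWeight (node (_ ∷ _)) = t

  youngTreeWeight : Tree → ℚ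
  youngTreeWeight T = youngEdgeWeight T * treeWeight T

  forestWeight : Forest → ℚ
  forestWeight []      = 1ℚ
  forestWeight (T ∷ r) = youngTreeWeight T * forestWeight r

  childrenWeight-young : ∀ sibs → isOne (length sibs) ≡ false →
                         ∀ i r → childrenWeight sibs (suc i) r ≡ forestWeight r
  childrenWeight-young sibs notSingle i []      = refl
  childrenWeight-young sibs notSingle i (T ∷ r) =
    cong₂ (λ w w′ → w * treeWeight T * w′) (young-edge T) (childrenWeight-young sibs notSingle (suc i) r)
    where
      young-edge : ∀ T → edgeWeight sibs (suc i) T ≡ youngEdgeWeight T
      young-edge (node [])      rewrite notSingle = refl
      young-edge (node (_ ∷ _)) = refl

  childrenWeight-afterFirst : ∀ T r → childrenWeight (T ∷ r) 1 r ≡ forestWeight r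
  childrenWeight-afterFirst T []      = refl
  childrenWeight-afterFirst T (S ∷ r) = childrenWeight-young (T ∷ S ∷ r) refl 0 (S ∷ r)

  treeWeight-singleLeaf : treeWeight (node [ node [] ]) ≡ a
  treeWeight-singleLeaf = unitFactors a
    where
      unitFactors : ∀ x → 1ℚ * (x * 1ℚ * 1ℚ) ≡ x
      unitFactors = solve-∀ ℚ-ring

  treeWeight-elderLeaf : ∀ T r → treeWeight (node (node [] ∷ T ∷ r)) ≡ b * forestWeight (T ∷ r)
  treeWeight-elderLeaf T r rewrite youngInterior-elderLeaf T r
                                 | childrenWeight-afterFirst (node []) (T ∷ r)
    = unitFactors b (forestWeight (T ∷ r))
    where
      unitFactors : ∀ x y → 1ℚ * (x * 1ℚ * y) ≡ x * y
      unitFactors = solve-∀ ℚ-ring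

  treeWeight-interiorFirst : ∀ T r′ r →
    treeWeight (node (node (T ∷ r′) ∷ r)) ≡ d * t * treeWeight (node (T ∷ r′)) * forestWeight r
  treeWeight-interiorFirst T r′ r rewrite youngInterior-interiorFirst T r′ r
                                        | childrenWeight-afterFirst (node (T ∷ r′)) r
    = unitFactor d t (treeWeight (node (T ∷ r′))) (forestWeight r)
    where
      unitFactor : ∀ x y z w → x * 1ℚ * (y * z * w) ≡ x * y * z * w
      unitFactor = solve-∀ ℚ-ring

  treeSeries : PowerSeries
  treeSeries = forestSum (treeWeight ∘ node)

  treeSeries⁺ : PowerSeries
  treeSeries⁺ = 0ℚ ◁ tail treeSeries

  youngForestSeries : PowerSeries
  youngForestSeries = forestSum forestWeight

  forestSum-youngTreeWeight : forestSum (youngTreeWeight ∘ node) ≗ t · (c ◁ tail treeSeries)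
  forestSum-youngTreeWeight zero    = singleVertex c t
    where
      singleVertex : ∀ x y → x * y * (1ℚ * 1ℚ) + 0ℚ ≡ y * x
      singleVertex = solve-∀ ℚ-ring
  forestSum-youngTreeWeight (suc j) = trans (forestSum-suc-cong (λ cs r → refl) j)
                                  (forestSum-*ˡ t (treeWeight ∘ node) (suc j))

  youngForestSeries-suc : ∀ m → youngForestSeries (suc m)
                                ≡ ((t · (c ◁ tail treeSeries)) ⊛ youngForestSeries) m
  youngForestSeries-suc m = trans (forestSum-cons (youngTreeWeight ∘ node) forestWeight (λ cs r → refl) m)
                                  (⊛-congʳ youngForestSeries forestSum-youngTreeWeight m)

  forestSum-leafFirst : ∀ m → forestSum (λ r → treeWeight (node (node [] ∷ r))) m
                          ≡ (a ◁ b · tail youngForestSeries) m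
  forestSum-leafFirst zero    = trans (ℚ.+-identityʳ _) treeWeight-singleLeaf
  forestSum-leafFirst (suc j) = trans (forestSum-suc-cong (λ cs r → treeWeight-elderLeaf (node cs) r) j)
                                  (forestSum-*ˡ b forestWeight (suc j))

  treeSeries-suc : ∀ m → treeSeries (suc m)
                         ≡ (a ◁ b · tail youngForestSeries) m + d * t * (treeSeries⁺ ⊛ youngForestSeries) m
  treeSeries-suc m = begin
      treeSeries (suc m)
    ≡⟨ forestSum-suc (treeWeight ∘ node) m ⟩
      sumℚ (map byFirstSubtree (upTo (suc m)))
    ≡⟨ sum-upTo-suc byFirstSubtree m ⟩
      byFirstSubtree 0 + sumℚ (map (byFirstSubtree ∘ suc) (upTo m))
    ≡⟨ cong₂ _+_ (trans (ℚ.+-identityʳ _) (forestSum-leafFirst m))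
                 (trans (sum-map-cong interiorFirst (upTo m)) (sum-*ˡ (d * t) _ (upTo m))) ⟩
      (a ◁ b · tail Y) m + d * t * sumℚ (map (λ j → P (suc j) * Y (m ∸ suc j)) (upTo m))
    ≡⟨ cong (λ z → (a ◁ b · tail Y) m + d * t * z) (sym noConstantTerm) ⟩
      (a ◁ b · tail Y) m + d * t * (treeSeries⁺ ⊛ Y) m ∎
    where
      open ≡-Reasoning
      P = treeSeries
      Y = youngForestSeries
      byFirstSubtree : ℕ → ℚ
      byFirstSubtree k = forestSum (λ cs → forestSum (λ r → treeWeight (node (node cs ∷ r))) (m ∸ k)) k
      interiorFirst : ∀ j → byFirstSubtree (suc j) ≡ d * t * (P (suc j) * Y (m ∸ suc j))
      interiorFirst j = begin
          byFirstSubtree (suc j)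
        ≡⟨ forestSum-suc-cong (λ cs r → trans (sum-map-cong (treeWeight-interiorFirst (node cs) r) (forests (m ∸ suc j)))
                                             (forestSum-*ˡ (d * t * treeWeight (node (node cs ∷ r))) forestWeight (m ∸ suc j))) j ⟩
          forestSum (λ cs → d * t * treeWeight (node cs) * Y (m ∸ suc j)) (suc j)
        ≡⟨ forestSum-*ʳ (Y (m ∸ suc j)) (λ cs → d * t * treeWeight (node cs)) (suc j) ⟩
          forestSum (λ cs → d * t * treeWeight (node cs)) (suc j) * Y (m ∸ suc j)
        ≡⟨ cong (_* Y (m ∸ suc j)) (forestSum-*ˡ (d * t) (treeWeight ∘ node) (suc j)) ⟩
          d * t * P (suc j) * Y (m ∸ suc j)
        ≡⟨ ℚ.*-assoc (d * t) (P (suc j)) (Y (m ∸ suc j)) ⟩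
          d * t * (P (suc j) * Y (m ∸ suc j)) ∎
      noConstantTerm : (treeSeries⁺ ⊛ Y) m ≡ sumℚ (map (λ j → P (suc j) * Y (m ∸ suc j)) (upTo m))
      noConstantTerm = trans (sum-upTo-suc (λ i → treeSeries⁺ i * Y (m ∸ i)) m)
                             (trans (cong (_+ sumℚ (map (λ j → P (suc j) * Y (m ∸ suc j)) (upTo m))) (ℚ.*-zeroˡ (Y m)))
                                    (ℚ.+-identityˡ _))

  youngForestSeries-equation :
    youngForestSeries ≗ 𝟏 ⊕ X ⊛ (const t ⊛ ((const c ⊕ treeSeries⁺) ⊛ youngForestSeries))
  youngForestSeries-equation = begin
      Y
    ≈⟨ ◁-tail Y ⟩
      1ℚ ◁ tail Y
    ≈⟨ ◁-horner ≗-refl youngForestSeries-suc ⟩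
      𝟏 ⊕ X ⊛ ((t · (c ◁ tail treeSeries)) ⊛ Y)
    ≈⟨ ⊕-congˡ 𝟏 (⊛-congˡ X (⊛-congʳ Y scaled)) ⟩
      𝟏 ⊕ X ⊛ ((const t ⊛ (const c ⊕ treeSeries⁺)) ⊛ Y)
    ≈⟨ ⊕-congˡ 𝟏 (⊛-congˡ X (⊛-assoc (const t) (const c ⊕ treeSeries⁺) Y)) ⟩
      𝟏 ⊕ X ⊛ (const t ⊛ ((const c ⊕ treeSeries⁺) ⊛ Y)) ∎
    where
      open ≗-Reasoning
      Y = youngForestSeries
      const⊕0◁ : ∀ k f → const k ⊕ (0ℚ ◁ f) ≗ k ◁ f
      const⊕0◁ k f zero    = ℚ.+-identityʳ k
      const⊕0◁ k f (suc n) = ℚ.+-identityˡ (f n)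
      scaled : t · (c ◁ tail treeSeries) ≗ const t ⊛ (const c ⊕ treeSeries⁺)
      scaled n = sym (trans (const-⊛ t (const c ⊕ treeSeries⁺) n) (cong (t *_) (const⊕0◁ c (tail treeSeries) n)))

  treeSeries⁺-equation : treeSeries⁺ ≗
    X ⊛ ((const b ⊛ youngForestSeries ⊕ (const a ⊖ const b)) ⊕ (const d ⊛ const t) ⊛ (treeSeries⁺ ⊛ youngForestSeries))
  treeSeries⁺-equation = begin
      treeSeries⁺
    ≈⟨ ◁-cong 0ℚ treeSeries-suc ⟩
      0ℚ ◁ ((a ◁ b · tail Y) ⊕ (d * t) · (treeSeries⁺ ⊛ Y))
    ≈⟨ ≗-sym (X-⊛ _) ⟩
      X ⊛ ((a ◁ b · tail Y) ⊕ (d * t) · (treeSeries⁺ ⊛ Y))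
    ≈⟨ ⊛-congˡ X (⊕-cong leafFirst scaled) ⟩
      X ⊛ ((const b ⊛ Y ⊕ (const a ⊖ const b)) ⊕ (const d ⊛ const t) ⊛ (treeSeries⁺ ⊛ Y)) ∎
    where
      open ≗-Reasoning
      Y = youngForestSeries
      leafFirst : a ◁ b · tail Y ≗ const b ⊛ Y ⊕ (const a ⊖ const b)
      leafFirst zero    = trans (elderCorrection a b) (cong (_+ (a - b)) (sym (const-⊛ b Y 0)))
        where
          elderCorrection : ∀ x y → x ≡ y * 1ℚ + (x - y)
          elderCorrection = solve-∀ ℚ-ring
      leafFirst (suc n) = trans (sym (ℚ.+-identityʳ _)) (cong (_+ 0ℚ) (sym (const-⊛ b Y (suc n))))
      scaled : (d * t) · (treeSeries⁺ ⊛ Y) ≗ (const d ⊛ const t) ⊛ (treeSeries⁺ ⊛ Y)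
      scaled n = sym (trans (⊛-congʳ (treeSeries⁺ ⊛ Y) (≗-sym (const-* d t)) n) (const-⊛ (d * t) (treeSeries⁺ ⊛ Y) n))

  G̃-series : PowerSeries
  G̃-series n = G̃ n a b c d t

  G̃-series≗treeSeries⁺ : G̃-series ≗ treeSeries⁺ ⊕ (d ◁ const (b - a))
  G̃-series≗treeSeries⁺ 0 = sym (ℚ.+-identityˡ d)
  G̃-series≗treeSeries⁺ 1 = trans (oneEdge a b) (cong (_+ (b - a)) (sym (trans (ℚ.+-identityʳ _) treeWeight-singleLeaf)))
    where
      oneEdge : ∀ x y → y ≡ x + (y - x)
      oneEdge = solve-∀ ℚ-ring
  G̃-series≗treeSeries⁺ (suc (suc k)) = begin
      sumℚ (map (weight a b c d t) (map node (forests (2 ℕ.+ k))))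
    ≡⟨ cong sumℚ (sym (map-∘ (forests (2 ℕ.+ k)))) ⟩
      sumℚ (map (weight a b c d t ∘ node) (forests (2 ℕ.+ k)))
    ≡⟨ sum-map-cong (weight≡treeWeight ∘ node) (forests (2 ℕ.+ k)) ⟩
      treeSeries (2 ℕ.+ k)
    ≡⟨ ℚ.+-identityʳ _ ⟨
      treeSeries (2 ℕ.+ k) + 0ℚ ∎
    where open ≡-Reasoning

numerator-cong : ∀ a b c d u {S S′} → S ≗ S′ → numerator a b c d u S ≗ numerator a b c d u S′
numerator-cong a b c d u S≗S′ 0                   = cong (λ z → u - z) (S≗S′ 0)
numerator-cong a b c d u S≗S′ 1                   = cong (λ z → (d - c) - z) (S≗S′ 1)
numerator-cong a b c d u S≗S′ 2                   = cong (λ z → (b - a) - z) (S≗S′ 2)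
numerator-cong a b c d u S≗S′ (suc (suc (suc n))) = cong -_ (S≗S′ (3 ℕ.+ n))

halve : ∀ x y → y ≡ ½ * (x - (x + - (2ℚ * y)))
halve = solve-∀ ℚ-ring

halve′ : ∀ y → y ≡ ½ * - (0ℚ + - (2ℚ * y))
halve′ = solve-∀ ℚ-ring

module SquareRoot (a b c d t : ℚ) .{{_ : NonZero t}} where
  open Weights a b c d t

  u : ℚ
  u = 1/ t

  A B C D T U : PowerSeries
  A = const a; B = const b; C = const c; D = const d; T = const t; U = const u

  sqrtWitness : PowerSeries
  sqrtWitness = (u ◁ (d - c) ◁ const (b - a)) ⊖ (0ℚ ◁ 2ℚ · G̃-series)

  sqrtWitness₀ : sqrtWitness 0 ≡ u
  sqrtWitness₀ = ℚ.+-identityʳ u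

  sqrtWitness-polynomial :
    sqrtWitness ≗ numeratorSeries X A B C D U ⊖ (two ⊛ X) ⊛ (treeSeries⁺ ⊕ (D ⊕ X ⊛ (B ⊖ A)))
  sqrtWitness-polynomial = ⊕-cong leading (⊝-cong doubled)
    where
      open ≗-Reasoning
      leading : u ◁ (d - c) ◁ const (b - a) ≗ numeratorSeries X A B C D U
      leading = ◁-horner ≗-refl (◁-horner (const-sub d c) (const-sub b a))
      doubled : 0ℚ ◁ 2ℚ · G̃-series ≗ (two ⊛ X) ⊛ (treeSeries⁺ ⊕ (D ⊕ X ⊛ (B ⊖ A)))
      doubled = begin
          0ℚ ◁ 2ℚ · G̃-series
        ≈⟨ ≗-sym (X-⊛ (2ℚ · G̃-series)) ⟩
          X ⊛ (2ℚ · G̃-series)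
        ≈⟨ ⊛-congˡ X (≗-sym (const-⊛ 2ℚ G̃-series)) ⟩
          X ⊛ (two ⊛ G̃-series)
        ≈⟨ solveₚ 2 (λ x g → x :* (con 2ℚ :* g) := (con 2ℚ :* x) :* g) ≗-refl X G̃-series ⟩
          (two ⊛ X) ⊛ G̃-series
        ≈⟨ ⊛-congˡ (two ⊛ X) (≗-trans G̃-series≗treeSeries⁺ (⊕-congˡ treeSeries⁺ (◁-horner ≗-refl (const-sub b a)))) ⟩
          (two ⊛ X) ⊛ (treeSeries⁺ ⊕ (D ⊕ X ⊛ (B ⊖ A))) ∎

  T⊛U≗𝟏 : T ⊛ U ≗ 𝟏
  T⊛U≗𝟏 = ≗-trans (≗-sym (const-* t u)) (λ n → cong (λ k → const k n) (ℚ.*-inverseʳ t))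

  sqrtWitness-squared : sqrtWitness ⊛ sqrtWitness ≗ radicand a b c d u
  sqrtWitness-squared = begin
      sqrtWitness ⊛ sqrtWitness
    ≈⟨ ⊛-cong sqrtWitness-polynomial sqrtWitness-polynomial ⟩
      _
    ≈⟨ completing-square X treeSeries⁺ A B C D U
         (tree-system-quadratic X youngForestSeries treeSeries⁺ A B C D T U
            T⊛U≗𝟏 youngForestSeries-equation treeSeries⁺-equation) ⟩
      radicandSeries X A B C D U
    ≈⟨ ≗-sym (radicand-polynomial a b c d u) ⟩
      radicand a b c d u ∎
    where open ≗-Reasoning

  G̃-series≡½numerator : ∀ n → G̃-series n ≡ ½ * numerator a b c d u sqrtWitness (suc n)
  G̃-series≡½numerator 0             = halve (d - c) (G̃-series 0)
  G̃-series≡½numerator 1             = halve (b - a) (G̃-series 1)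
  G̃-series≡½numerator (suc (suc k)) = halve′ (G̃-series (2 ℕ.+ k))

  u+u≢0 : u + u ≢ 0ℚ
  u+u≢0 u+u≡0 = ℚ.1≢0 (begin
      1ℚ          ≡⟨ ℚ.*-inverseʳ t ⟨
      t * u       ≡⟨ cong (t *_) (trans (half-double u) (cong (½ *_) u+u≡0)) ⟩
      t * (½ * 0ℚ) ≡⟨ cong (t *_) (ℚ.*-zeroʳ ½) ⟩
      t * 0ℚ      ≡⟨ ℚ.*-zeroʳ t ⟩
      0ℚ          ∎)
    where
      open ≡-Reasoning
      half-double : ∀ x → x ≡ ½ * (x + x)
      half-double = solve-∀ ℚ-ring

  sqrtWitness-unique : ∀ S → IsSqrtWithConst u (radicand a b c d u) S → sqrtWitness ≗ S
  sqrtWitness-unique S (S₀≡u , S²≗R) =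
    sqrt-unique sqrtWitness S (u+u≢0 ∘ trans (cong₂ _+_ (sym sqrtWitness₀) (sym S₀≡u)))
                (λ n → trans (sqrtWitness-squared n) (sym (S²≗R n)))

theorem3p2 : (a b c d t : ℚ) → .{{_ : NonZero t}} →
    Σ PowerSeries (IsSqrtWithConst (1/ t) (radicand a b c d (1/ t)))
    × ((S : PowerSeries) → IsSqrtWithConst (1/ t) (radicand a b c d (1/ t)) S →
       (numerator a b c d (1/ t) S 0 ≡ 0ℚ)
       × ((n : ℕ) → G̃ n a b c d t ≡ ½ * numerator a b c d (1/ t) S (suc n)))
theorem3p2 a b c d t =
    (sqrtWitness , sqrtWitness₀ , sqrtWitness-squared)
  , λ S isSqrt →
        trans (cong (λ z → u - z) (proj₁ isSqrt)) (ℚ.+-inverseʳ u)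
      , λ n → trans (G̃-series≡½numerator n)
                    (cong (½ *_) (numerator-cong a b c d u (sqrtWitness-unique S isSqrt) (suc n)))
  where open SquareRoot a b c d t
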